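{- Let $(A,\rightarrow,\rightsquigarrow,0,1)$ be a bounded pseudo-BE(A) algebra. Then $s\mapsto 1-s$ is a bijection from the set $\mathcal{BS}_1(A)$ of Bosbach states $s$ on $A$ with $s(0)=0$ onto the set $\mathcal{MS}(A)$ of state-measures on $A$, with inverse $m\mapsto 1-m$. In particular, there is a one-to-one correspondence between $\mathcal{BS}_1(A)$ and $\mathcal{MS}(A)$.
   Context: A pseudo-BE algebra is an algebra $(A,\rightarrow,\rightsquigarrow,1)$ of type $(2,2,0)$ such that for all $x,y,z\in A$: $x\rightarrow x=x\rightsquigarrow x=1$; $x\rightarrow 1=x\rightsquigarrow 1=1$; $1\rightarrow x=1\rightsquigarrow x=x$; $x\rightarrow(y\rightsquigarrow z)=y\rightsquigarrow(x\rightarrow z)$; $x\rightarrow y=1$ iff $x\rightsquigarrow y=1$. Write $x\le y$ iff $x\rightarrow y=1$. It is a pseudo-BE(A) algebra if $x\le y$ implies $y\rightarrow z\le x\rightarrow z$ and $y\rightsquigarrow z\le x\rightsquigarrow z$ for all $z$. It is bounded if there is $0\in A$ with $0\le x$ for all $x$. A Bosbach state is a map $s:A\to[0,1]$ with $s(1)=1$, $s(x)+s(x\rightarrow y)=s(y)+s(y\rightarrow x)$ and $s(x)+s(x\rightsquigarrow y)=s(y)+s(y\rightsquigarrow x)$ for all $x,y$. A measure is a map $m:A\to[0,\infty)$ such that $m(x\rightarrow y)=m(x\rightsquigarrow y)=m(y)-m(x)$ whenever $y\le x$; a state-measure (for bounded $A$) is a measure with $m(0)=1$. -}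

module Defs where

open import Level using (0ℓ)
open import Relation.Binary.PropositionalEquality using (_≡_)
open import Relation.Nullary using (¬_)
open import Data.Product using (Σ; _×_; ∃)
open import Data.Sum using (_⊎_)

-- The real numbers, axiomatised as a complete ordered field.
-- (agda-stdlib has no reals; every complete ordered field is isomorphic
-- to ℝ, so quantifying over such a structure is a faithful rendering.)

record CompleteOrderedField : Set₁ where
  infixl 6 _+_ _-_
  infixl 7 _*_
  infix  4 _≤_
  field
    R    : Set
    _+_  : R → R → R
    _*_  : R → R → R
    -_   : R → R
    0r   : R
    1r   : R
    _≤_  : R → R → Set
    +-assoc   : ∀ x y z → (x + y) + z ≡ x + (y + z)
    +-comm    : ∀ x y → x + y ≡ y + x
    +-identityˡ : ∀ x → 0r + x ≡ x
    -‿inverseˡ : ∀ x → (- x) + x ≡ 0r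
    *-assoc   : ∀ x y z → (x * y) * z ≡ x * (y * z)
    *-comm    : ∀ x y → x * y ≡ y * x
    *-identityˡ : ∀ x → 1r * x ≡ x
    *-inverse : ∀ x → ¬ (x ≡ 0r) → Σ R (λ y → y * x ≡ 1r)
    distribˡ  : ∀ x y z → x * (y + z) ≡ (x * y) + (x * z)
    0≢1       : ¬ (0r ≡ 1r)
    ≤-refl    : ∀ x → x ≤ x
    ≤-trans   : ∀ {x y z} → x ≤ y → y ≤ z → x ≤ z
    ≤-antisym : ∀ {x y} → x ≤ y → y ≤ x → x ≡ y
    ≤-total   : ∀ x y → (x ≤ y) ⊎ (y ≤ x)
    +-mono-≤  : ∀ {x y} z → x ≤ y → x + z ≤ y + z
    *-nonneg  : ∀ {x y} → 0r ≤ x → 0r ≤ y → 0r ≤ x * y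
    sup : (P : R → Set) → ∃ P → (Σ R λ b → ∀ x → P x → x ≤ b) →
          Σ R λ u → (∀ x → P x → x ≤ u) × (∀ b → (∀ x → P x → x ≤ b) → u ≤ b)

  _-_ : R → R → R
  x - y = x + (- y)

record BoundedPseudoBEA : Set₁ where
  infixr 5 _⇒_ _⇝_
  field
    A    : Set
    _⇒_  : A → A → A
    _⇝_  : A → A → A
    one  : A
    zero : A
    ⇒-refl  : ∀ x → x ⇒ x ≡ one
    ⇝-refl  : ∀ x → x ⇝ x ≡ one
    ⇒-one   : ∀ x → x ⇒ one ≡ one
    ⇝-one   : ∀ x → x ⇝ one ≡ one
    one-⇒   : ∀ x → one ⇒ x ≡ x
    one-⇝   : ∀ x → one ⇝ x ≡ x
    exchange : ∀ x y z → x ⇒ (y ⇝ z) ≡ y ⇝ (x ⇒ z)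
    ⇒1→⇝1   : ∀ x y → x ⇒ y ≡ one → x ⇝ y ≡ one
    ⇝1→⇒1   : ∀ x y → x ⇝ y ≡ one → x ⇒ y ≡ one

  _≼_ : A → A → Set
  x ≼ y = x ⇒ y ≡ one

  field
    antitone-⇒ : ∀ {x y} z → x ≼ y → (y ⇒ z) ≼ (x ⇒ z)
    antitone-⇝ : ∀ {x y} z → x ≼ y → (y ⇝ z) ≼ (x ⇝ z)
    zero-least : ∀ x → zero ≼ x

module _ (F : CompleteOrderedField) (𝔸 : BoundedPseudoBEA) where
  open CompleteOrderedField F
  open BoundedPseudoBEA 𝔸

  record IsBosbachState (s : A → R) : Set where
    field
      range-lo : ∀ x → 0r ≤ s x
      range-hi : ∀ x → s x ≤ 1r
      s-one    : s one ≡ 1r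
      bosbach-⇒ : ∀ x y → s x + s (x ⇒ y) ≡ s y + s (y ⇒ x)
      bosbach-⇝ : ∀ x y → s x + s (x ⇝ y) ≡ s y + s (y ⇝ x)

  record IsBosbachState₁ (s : A → R) : Set where
    field
      isBosbachState : IsBosbachState s
      s-zero         : s zero ≡ 0r

  record IsMeasure (m : A → R) : Set where
    field
      nonneg    : ∀ x → 0r ≤ m x
      measure-⇒ : ∀ x y → y ≼ x → m (x ⇒ y) ≡ m y - m x
      measure-⇝ : ∀ x y → y ≼ x → m (x ⇝ y) ≡ m y - m x

  record IsStateMeasure (m : A → R) : Set where
    field
      isMeasure : IsMeasure m
      m-zero    : m zero ≡ 1r

  BS₁ : Set
  BS₁ = Σ (A → R) IsBosbachState₁

  MS : Set
  MS = Σ (A → R) IsStateMeasure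

module Submission where

-- The direction "state ⇒ measure" is a direct computation: if y ≤ x then
-- s(y → x) = s(1) = 1, so the Bosbach law reads s(x) + s(x → y) = s(y) + 1,
-- which is exactly the measure law for 1 - s.  For the converse the key
-- fact is that every measure satisfies the Bosbach law itself,
--   m(x) + m(x → y) = m(y) + m(y → x),
-- obtained by antisymmetry from the inequality m(y) + m(y → x) ≤
-- m(x) + m(x → y).  That inequality compares y → x with p → x, where
-- p = (x → y) ⇝ y lies above both x and y, and uses the (A) condition.
-- Everything is proved for → only: the axioms are symmetric in → and ⇝, so
-- the ⇝-versions are the →-versions for the dual algebra (arrows swapped).

open import Defs
open import Level using (0ℓ)
open import Data.Product using (_×_; _,_)
open import Relation.Binary.PropositionalEquality
  using (_≡_; refl; sym; trans; cong; cong₂; subst; isEquivalence; module ≡-Reasoning)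
open import Algebra.Bundles using (AbelianGroup)
import Algebra.Properties.AbelianGroup as AbelianGroupProperties
import Algebra.Properties.CommutativeSemigroup as CommutativeSemigroupProperties

module Arithmetic (F : CompleteOrderedField) where
  open CompleteOrderedField F
  open ≡-Reasoning

  -- The additive group of the field, so that the stdlib's group laws apply;
  -- the group's division x // y is, definitionally, x - y.
  +-abelianGroup : AbelianGroup 0ℓ 0ℓ
  +-abelianGroup = record
    { isAbelianGroup = record
      { isGroup = record
        { isMonoid = record
          { isSemigroup = record
            { isMagma = record { isEquivalence = isEquivalence ; ∙-cong = cong₂ _+_ }
            ; assoc = +-assoc }
          ; identity = +-identityˡ , λ x → trans (+-comm x 0r) (+-identityˡ x) }
        ; inverse = -‿inverseˡ , λ x → trans (+-comm x (- x)) (-‿inverseˡ x)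
        ; ⁻¹-cong = cong (-_) }
      ; comm = +-comm } }

  open AbelianGroup +-abelianGroup public using (identityʳ; inverseʳ)
  open AbelianGroupProperties +-abelianGroup
    using (⁻¹-anti-homo‿-; ⁻¹-∙-comm; ε⁻¹≈ε; //-rightDividesˡ)
  open CommutativeSemigroupProperties (AbelianGroup.commutativeSemigroup +-abelianGroup)
    using (interchange)

  c-0≡c : ∀ c → c - 0r ≡ c
  c-0≡c c = trans (cong (c +_) ε⁻¹≈ε) (identityʳ c)

  [x+z]-[y+z]≡x-y : ∀ x y z → (x + z) - (y + z) ≡ x - y
  [x+z]-[y+z]≡x-y x y z = begin
    (x + z) + - (y + z)    ≡⟨ cong ((x + z) +_) (sym (⁻¹-∙-comm y z)) ⟩
    (x + z) + (- y + - z)  ≡⟨ interchange x z (- y) (- z) ⟩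
    (x - y) + (z - z)      ≡⟨ cong ((x - y) +_) (inverseʳ z) ⟩
    (x - y) + 0r           ≡⟨ identityʳ (x - y) ⟩
    x - y                  ∎

  c-[c-a]≡a : ∀ c a → c - (c - a) ≡ a
  c-[c-a]≡a c a = begin
    c + - (c - a)  ≡⟨ cong (c +_) (⁻¹-anti-homo‿- c a) ⟩
    c + (a - c)    ≡⟨ cong (c +_) (+-comm a (- c)) ⟩
    c + (- c + a)  ≡⟨ sym (+-assoc c (- c) a) ⟩
    (c - c) + a    ≡⟨ cong (_+ a) (inverseʳ c) ⟩
    0r + a         ≡⟨ +-identityˡ a ⟩
    a              ∎

  [c-b]-[c-a]≡a-b : ∀ c a b → (c - b) - (c - a) ≡ a - b
  [c-b]-[c-a]≡a-b c a b = begin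
    (c - b) + - (c - a)    ≡⟨ cong ((c - b) +_) (⁻¹-anti-homo‿- c a) ⟩
    (c + - b) + (a + - c)  ≡⟨ interchange c (- b) a (- c) ⟩
    (c + a) + (- b + - c)  ≡⟨ cong₂ _+_ (+-comm c a) (⁻¹-∙-comm b c) ⟩
    (a + c) - (b + c)      ≡⟨ [x+z]-[y+z]≡x-y a b c ⟩
    a - b                  ∎

  complement-sums : ∀ c a b a' b' → a + b ≡ a' + b' →
                    (c - a) + (c - b) ≡ (c - a') + (c - b')
  complement-sums c a b a' b' a+b≡a'+b' = begin
    (c + - a) + (c + - b)    ≡⟨ interchange c (- a) c (- b) ⟩
    (c + c) + (- a + - b)    ≡⟨ cong ((c + c) +_) (⁻¹-∙-comm a b) ⟩
    (c + c) - (a + b)        ≡⟨ cong (λ z → (c + c) - z) a+b≡a'+b' ⟩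
    (c + c) - (a' + b')      ≡⟨ cong ((c + c) +_) (sym (⁻¹-∙-comm a' b')) ⟩
    (c + c) + (- a' + - b')  ≡⟨ interchange c c (- a') (- b') ⟩
    (c + - a') + (c + - b')  ∎

  -- If a + t = b + c then c - t is the difference of the complements of b
  -- and a (the measure law for 1 - s).
  complement-difference : ∀ c a b t → a + t ≡ b + c → c - t ≡ (c - b) - (c - a)
  complement-difference c a b t a+t≡b+c = begin
    c - t              ≡⟨ sym ([x+z]-[y+z]≡x-y c t b) ⟩
    (c + b) - (t + b)  ≡⟨ cong₂ _-_ (+-comm c b) (+-comm t b) ⟩
    (b + c) - (b + t)  ≡⟨ cong (_- (b + t)) (sym a+t≡b+c) ⟩
    (a + t) - (b + t)  ≡⟨ [x+z]-[y+z]≡x-y a b t ⟩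
    a - b              ≡⟨ sym ([c-b]-[c-a]≡a-b c a b) ⟩
    (c - b) - (c - a)  ∎

  ≤-add : ∀ {x y x' y'} z → x + z ≡ x' → y + z ≡ y' → x ≤ y → x' ≤ y'
  ≤-add z refl refl x≤y = +-mono-≤ z x≤y

  0≤c-a : ∀ {a c} → a ≤ c → 0r ≤ c - a
  0≤c-a {a} = ≤-add (- a) (inverseʳ a) refl

  c-a≤c : ∀ {a} c → 0r ≤ a → c - a ≤ c
  c-a≤c {a} c = ≤-add (c - a) (+-identityˡ (c - a))
    (trans (+-comm a (c - a)) (//-rightDividesˡ a c))

  0≤a-b⇒b≤a : ∀ {a b} → 0r ≤ a - b → b ≤ a
  0≤a-b⇒b≤a {a} {b} = ≤-add b (+-identityˡ b) (//-rightDividesˡ b a)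

  ≤-rearrange : ∀ {a b c d} → d ≤ a - (c - b) → c + d ≤ a + b
  ≤-rearrange {a} {b} {c} {d} = ≤-add c (+-comm d c) (begin
    (a + - (c - b)) + c  ≡⟨ cong (λ z → (a + z) + c) (⁻¹-anti-homo‿- c b) ⟩
    (a + (b - c)) + c    ≡⟨ +-assoc a (b - c) c ⟩
    a + ((b - c) + c)    ≡⟨ cong (a +_) (//-rightDividesˡ c b) ⟩
    a + b                ∎)

module PseudoBE (𝔸 : BoundedPseudoBEA) where
  open BoundedPseudoBEA 𝔸

  y≼x⇝y : ∀ x y → y ≼ (x ⇝ y)
  y≼x⇝y x y = trans (exchange y x y) (trans (cong (x ⇝_) (⇒-refl y)) (⇝-one x))

  y≼x⇒y : ∀ x y → y ≼ (x ⇒ y)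
  y≼x⇒y x y = ⇝1→⇒1 y (x ⇒ y)
    (trans (sym (exchange x y y)) (trans (cong (x ⇒_) (⇝-refl y)) (⇒-one x)))

  x≼[x⇒y]⇝y : ∀ x y → x ≼ ((x ⇒ y) ⇝ y)
  x≼[x⇒y]⇝y x y = trans (exchange x (x ⇒ y) y) (⇝-refl (x ⇒ y))

  dual : BoundedPseudoBEA
  dual = record
    { A = A ; _⇒_ = _⇝_ ; _⇝_ = _⇒_ ; one = one ; zero = zero
    ; ⇒-refl = ⇝-refl ; ⇝-refl = ⇒-refl
    ; ⇒-one = ⇝-one ; ⇝-one = ⇒-one
    ; one-⇒ = one-⇝ ; one-⇝ = one-⇒
    ; exchange = λ x y z → sym (exchange y x z)
    ; ⇒1→⇝1 = ⇝1→⇒1 ; ⇝1→⇒1 = ⇒1→⇝1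
    ; antitone-⇒ = λ z x≼y → ⇒1→⇝1 _ _ (antitone-⇝ z (⇝1→⇒1 _ _ x≼y))
    ; antitone-⇝ = λ z x≼y → ⇒1→⇝1 _ _ (antitone-⇒ z (⇝1→⇒1 _ _ x≼y))
    ; zero-least = λ x → ⇒1→⇝1 _ _ (zero-least x)
    }

module Measure (F : CompleteOrderedField) (𝔸 : BoundedPseudoBEA) where
  open CompleteOrderedField F
  open BoundedPseudoBEA 𝔸
  open Arithmetic F
  open PseudoBE 𝔸

  dual-measure : ∀ {m} → IsMeasure F 𝔸 m → IsMeasure F dual m
  dual-measure M = record
    { nonneg = nonneg
    ; measure-⇒ = λ x y y≼x → measure-⇝ x y (⇝1→⇒1 y x y≼x)
    ; measure-⇝ = λ x y y≼x → measure-⇒ x y (⇝1→⇒1 y x y≼x)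
    }
    where open IsMeasure M

  module _ {m : A → R} (M : IsMeasure F 𝔸 m) where
    open IsMeasure M

    measure-one : m one ≡ 0r
    measure-one = begin
      m one          ≡⟨ cong m (sym (⇒-refl one)) ⟩
      m (one ⇒ one)  ≡⟨ measure-⇒ one one (⇒-refl one) ⟩
      m one - m one  ≡⟨ inverseʳ (m one) ⟩
      0r             ∎
      where open ≡-Reasoning

    measure-antitone : ∀ {a b} → a ≼ b → m b ≤ m a
    measure-antitone {a} {b} a≼b =
      0≤a-b⇒b≤a (subst (0r ≤_) (measure-⇒ b a a≼b) (nonneg (b ⇒ a)))

    -- Half of the Bosbach law.  With u = x → y and p = u ⇝ y we have
    -- x, y ≤ p, hence m(y → x) ≤ m(p → x) = m(x) - m(p) = m(x) - (m(y) - m(u)).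
    measure-bosbach-≤ : ∀ x y → m y + m (y ⇒ x) ≤ m x + m (x ⇒ y)
    measure-bosbach-≤ x y = ≤-rearrange
      (subst (m (y ⇒ x) ≤_) m[p⇒x] (measure-antitone (antitone-⇒ x (y≼x⇝y u y))))
      where
      u = x ⇒ y
      p = u ⇝ y
      m[p⇒x] : m (p ⇒ x) ≡ m x - (m y - m u)
      m[p⇒x] = trans (measure-⇒ p x (x≼[x⇒y]⇝y x y))
                     (cong (λ z → m x - z) (measure-⇝ u y (y≼x⇒y x y)))

    measure-bosbach : ∀ x y → m x + m (x ⇒ y) ≡ m y + m (y ⇒ x)
    measure-bosbach x y = ≤-antisym (measure-bosbach-≤ y x) (measure-bosbach-≤ x y)

module Correspondence (F : CompleteOrderedField) (𝔸 : BoundedPseudoBEA) where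
  open CompleteOrderedField F
  open BoundedPseudoBEA 𝔸
  open Arithmetic F
  open PseudoBE 𝔸 using (dual)
  open Measure F 𝔸 using (dual-measure; measure-one; measure-bosbach)
  open Measure F dual using () renaming (measure-bosbach to measure-bosbach-⇝)

  bosbach₁⇒stateMeasure : (s : A → R) → IsBosbachState₁ F 𝔸 s →
                          IsStateMeasure F 𝔸 (λ x → 1r - s x)
  bosbach₁⇒stateMeasure s S = record
    { isMeasure = record
      { nonneg    = λ x → 0≤c-a (range-hi x)
      ; measure-⇒ = λ x y y≼x → complement-difference 1r (s x) (s y) (s (x ⇒ y))
          (trans (bosbach-⇒ x y) (cong (s y +_) (trans (cong s y≼x) s-one)))
      ; measure-⇝ = λ x y y≼x → complement-difference 1r (s x) (s y) (s (x ⇝ y))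
          (trans (bosbach-⇝ x y) (cong (s y +_) (trans (cong s (⇒1→⇝1 y x y≼x)) s-one)))
      }
    ; m-zero = trans (cong (λ z → 1r - z) s-zero) (c-0≡c 1r)
    }
    where
    open IsBosbachState₁ S
    open IsBosbachState isBosbachState

  stateMeasure⇒bosbach₁ : (m : A → R) → IsStateMeasure F 𝔸 m →
                          IsBosbachState₁ F 𝔸 (λ x → 1r - m x)
  stateMeasure⇒bosbach₁ m M = record
    { isBosbachState = record
      -- 1 - m(x) = m(0) - m(x) = m(x → 0) ≥ 0
      { range-lo  = λ x → subst (0r ≤_)
          (trans (measure-⇒ x zero (zero-least x)) (cong (_- m x) m-zero))
          (nonneg (x ⇒ zero))
      ; range-hi  = λ x → c-a≤c 1r (nonneg x)
      ; s-one     = trans (cong (λ z → 1r - z) (measure-one isMeasure)) (c-0≡c 1r)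
      ; bosbach-⇒ = λ x y → complement-sums 1r _ _ _ _ (measure-bosbach isMeasure x y)
      ; bosbach-⇝ = λ x y → complement-sums 1r _ _ _ _
          (measure-bosbach-⇝ (dual-measure isMeasure) x y)
      }
    ; s-zero = trans (cong (λ z → 1r - z) m-zero) (inverseʳ 1r)
    }
    where
    open IsStateMeasure M
    open IsMeasure isMeasure

theorem3p18 : (F : CompleteOrderedField) (𝔸 : BoundedPseudoBEA) →
    let open CompleteOrderedField F
        open BoundedPseudoBEA 𝔸
    in ((s : A → R) → IsBosbachState₁ F 𝔸 s → IsStateMeasure F 𝔸 (λ x → 1r - s x))
       × ((m : A → R) → IsStateMeasure F 𝔸 m → IsBosbachState₁ F 𝔸 (λ x → 1r - m x))
       × ((s : A → R) → IsBosbachState₁ F 𝔸 s → ∀ x → 1r - (1r - s x) ≡ s x)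
       × ((m : A → R) → IsStateMeasure F 𝔸 m → ∀ x → 1r - (1r - m x) ≡ m x)
theorem3p18 F 𝔸 =
    bosbach₁⇒stateMeasure
  , stateMeasure⇒bosbach₁
  , (λ s _ x → c-[c-a]≡a 1r (s x))
  , (λ m _ x → c-[c-a]≡a 1r (m x))
  where
  open CompleteOrderedField F using (1r)
  open Arithmetic F using (c-[c-a]≡a)
  open Correspondence F 𝔸 using (bosbach₁⇒stateMeasure; stateMeasure⇒bosbach₁)
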